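{- Let $G=(A,B,E)$ be a connected bipartite graph with at least two vertices. Then $G$ is $\alpha$-stable if and only if there exist $k\geq 1$ and subgraphs $G_1,\dots,G_k$ of $G$ whose vertex sets partition $V(G)$, such that each $G_i=(A_i,B_i,E_i)$, with $A_i=A\cap V(G_i)$ and $B_i=B\cap V(G_i)$, is bistable and $\alpha$-stable.
   Context: All graphs are finite and simple. $\alpha(G)$ is the largest size of a stable set (set of pairwise nonadjacent vertices); a maximum stable set is a stable set of size $\alpha(G)$. $G$ is $\alpha^-$-stable if $\alpha(G-e)=\alpha(G)$ for every edge $e$; $\alpha^+$-stable if $\alpha(G+e)=\alpha(G)$ for every pair $e=xy$ of distinct nonadjacent vertices; $\alpha$-stable if both. A bipartite graph $(A_i,B_i,E_i)$ is bistable if $A_i$ and $B_i$ are exactly its two maximum stable sets. -}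

module Defs where

open import Data.Nat using (ℕ; zero; suc; _⊔_)
open import Data.Bool using (Bool; true; false; _∧_; _∨_; not; if_then_else_)
open import Data.Bool.Properties using () renaming (_≟_ to _≟ᵇ_)
open import Data.Fin using (Fin; _≟_)
open import Data.Fin.Properties using (all?)
open import Data.Fin.Subset using (Subset; _∈_; _∉_; _⊆_; _∩_; ∣_∣)
open import Data.Fin.Subset.Properties using (_∈?_; _⊆?_)
open import Data.Vec using (Vec; []; _∷_)
open import Data.List using (List; map; _++_; foldr; filter) renaming ([] to []ˡ; _∷_ to _∷ˡ_)
open import Data.Product using (Σ; _×_; _,_; proj₁; proj₂)
open import Data.Sum using (_⊎_)
open import Relation.Nullary using (Dec; yes; no; ¬_; _×-dec_; ⌊_⌋; _→-dec_)
open import Relation.Binary.PropositionalEquality using (_≡_; _≢_)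

record Graph (n : ℕ) : Set where
  field
    V      : Subset n
    adj    : Fin n → Fin n → Bool
    adj-sym : ∀ u v → adj u v ≡ adj v u
    adj-irr : ∀ u → adj u u ≡ false
    adj-V  : ∀ u v → adj u v ≡ true → (u ∈ V × v ∈ V)

IsStable : ∀ {n} → Subset n → (Fin n → Fin n → Bool) → Subset n → Set
IsStable V adj S = S ⊆ V × (∀ u v → u ∈ S → v ∈ S → adj u v ≡ false)

stable? : ∀ {n} (V : Subset n) (adj : Fin n → Fin n → Bool) (S : Subset n) → Dec (IsStable V adj S)
stable? V adj S = (S ⊆? V) ×-dec all? (λ u → all? (λ v → (u ∈? S) →-dec ((v ∈? S) →-dec (adj u v ≟ᵇ false))))

allSubsets : ∀ n → List (Subset n)
allSubsets zero = [] ∷ˡ []ˡ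
allSubsets (suc n) = map (true ∷_) (allSubsets n) ++ map (false ∷_) (allSubsets n)

α : ∀ {n} → Subset n → (Fin n → Fin n → Bool) → ℕ
α {n} V adj = foldr _⊔_ 0 (map ∣_∣ (filter (stable? V adj) (allSubsets n)))

samePair : ∀ {n} → Fin n → Fin n → Fin n → Fin n → Bool
samePair x y a b = (⌊ a ≟ x ⌋ ∧ ⌊ b ≟ y ⌋) ∨ (⌊ a ≟ y ⌋ ∧ ⌊ b ≟ x ⌋)

deleteEdge : ∀ {n} → (Fin n → Fin n → Bool) → Fin n → Fin n → (Fin n → Fin n → Bool)
deleteEdge adj x y a b = adj a b ∧ not (samePair x y a b)

addEdge : ∀ {n} → (Fin n → Fin n → Bool) → Fin n → Fin n → (Fin n → Fin n → Bool)
addEdge adj x y a b = adj a b ∨ samePair x y a b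

module _ {n : ℕ} (G : Graph n) where
  open Graph G

  αG : ℕ
  αG = α V adj

  IsMaximumStable : Subset n → Set
  IsMaximumStable S = IsStable V adj S × ∣ S ∣ ≡ αG

  α⁻-stable : Set
  α⁻-stable = ∀ x y → adj x y ≡ true → α V (deleteEdge adj x y) ≡ αG

  α⁺-stable : Set
  α⁺-stable = ∀ x y → x ∈ V → y ∈ V → x ≢ y → adj x y ≡ false →
              α V (addEdge adj x y) ≡ αG

  α-stable : Set
  α-stable = α⁺-stable × α⁻-stable

  IsBipartition : Subset n → Subset n → Set
  IsBipartition A B =
    (∀ v → v ∈ A → v ∉ B) ×
    (∀ v → v ∈ V → v ∈ A ⊎ v ∈ B) ×
    A ⊆ V × B ⊆ V ×
    (∀ u v → adj u v ≡ true → (u ∈ A × v ∈ B) ⊎ (u ∈ B × v ∈ A))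

  Bistable : Subset n → Subset n → Set
  Bistable A B =
    IsMaximumStable A × IsMaximumStable B × A ≢ B ×
    (∀ S → IsMaximumStable S → S ≡ A ⊎ S ≡ B)

  data Reach : Fin n → Fin n → Set where
    here : ∀ {u} → Reach u u
    step : ∀ {u w v} → adj u w ≡ true → Reach w v → Reach u v

  Connected : Set
  Connected = ∀ u v → u ∈ V → v ∈ V → Reach u v

IsSubgraph : ∀ {n} → Graph n → Graph n → Set
IsSubgraph H G = Graph.V H ⊆ Graph.V G × (∀ u v → Graph.adj H u v ≡ true → Graph.adj G u v ≡ true)

module Submission where

-- An α-stable G has both sides maximum stable. The maximum stable sets are closed under
-- "meet on A, join on B", and a least one S meets A in at most one vertex: two such vertices could
-- be joined without lowering α, yet every maximum stable set contains them. Trading that vertex for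
-- a neighbour in B gives α = |S| ≤ |B|, and symmetrically α ≤ |A|. Now call a nonempty α⁻-stable
-- subgraph H whose two sides are maximum stable a piece. If H has a third maximum stable set S, the
-- vertices where S agrees with A and those where S agrees with B induce two smaller pieces;
-- otherwise H is bistable. Conversely, blockwise counting shows that a partition into bistable
-- α-stable blocks keeps A and B maximum stable in G and in every G - e.

open import Defs
open import Data.Nat using (ℕ; zero; suc; _+_; _⊔_; _≤_; _<_; _≥_; _<?_; z≤n; s≤s) renaming (_≟_ to _≟ℕ_)
open import Data.Nat.Properties hiding (_≟_)
open import Data.Nat.Induction using (<-wellFounded)
open import Data.Bool using (Bool; true; false; _∧_; _∨_; not; if_then_else_)
open import Data.Bool.Properties using (∧-comm; ∧-conicalˡ; ∧-conicalʳ) renaming (_≟_ to _≟ᵇ_)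
open import Data.Fin using (Fin; zero; suc; _≟_; splitAt; _↑ˡ_; _↑ʳ_)
import Data.Fin.Properties as Fin
open import Data.Fin.Subset using (Subset; _∈_; _∉_; _⊆_; _⊂_; _∩_; _∪_; ∣_∣; ⁅_⁆; Nonempty; inside; outside) renaming (⊥ to ∅)
open import Data.Fin.Subset.Properties
  using (_∈?_; ∉⊥; ⊥⊆; ∣⊥∣≡0; p∩q⊆p; p⊆q⇒∣p∣≤∣q∣; p⊂q⇒∣p∣<∣q∣; ⊆-antisym; x∈⁅x⁆; x∈⁅y⁆⇒x≡y; ∣⁅x⁆∣≡1;
         x∈p∩q⁺; x∈p∩q⁻; x∈p∪q⁺; x∈p∪q⁻; nonempty?; anySubset?)
open import Data.Vec using ([]; _∷_; lookup; tabulate)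
open import Data.Vec.Properties using (≡-dec; lookup∘tabulate; []=⇒lookup; lookup⇒[]=; lookup-zipWith)
open import Data.Vec.Functional using (Vector)
open import Data.List using (List; []; _∷_; map; filter; foldr)
open import Data.List.Relation.Unary.Any using (here; there)
open import Data.List.Membership.Propositional using () renaming (_∈_ to _∈ˡ_)
open import Data.List.Membership.Propositional.Properties using (∈-++⁺ˡ; ∈-++⁺ʳ; ∈-map⁺; ∈-map⁻; ∈-filter⁺; ∈-filter⁻)
open import Data.Product using (Σ; ∃; _×_; _,_; proj₁; proj₂)
open import Data.Sum using (_⊎_; inj₁; inj₂; [_,_]′)
import Data.Sum
open import Data.Empty using (⊥; ⊥-elim)
open import Function.Base using (case_of_)
open import Function.Bundles using (_⇔_; mk⇔)
open import Induction.WellFounded using (Acc; acc)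
open import Relation.Nullary using (Dec; yes; no; ⌊_⌋; _×-dec_)
open import Relation.Nullary.Decidable using (decidable-stable; ¬?)
open import Relation.Binary.PropositionalEquality
open import Algebra.Properties.CommutativeMonoid.Sum +-0-commutativeMonoid
  using (sum; sum-syntax; ∑-comm; ∑-distrib-+; sum-cong-≗)

𝟙 : Bool → ℕ
𝟙 true  = 1
𝟙 false = 0

∈⇒lookup : ∀ {n} {v : Fin n} {p : Subset n} → v ∈ p → lookup p v ≡ true
∈⇒lookup = []=⇒lookup

lookup⇒∈ : ∀ {n} {v : Fin n} {p : Subset n} → lookup p v ≡ true → v ∈ p
lookup⇒∈ {v = v} {p} = lookup⇒[]= v p

∉⇒lookup : ∀ {n} {v : Fin n} {p : Subset n} → v ∉ p → lookup p v ≡ false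
∉⇒lookup {v = v} {p} v∉p with lookup p v in eq
... | true  = ⊥-elim (v∉p (lookup⇒∈ eq))
... | false = refl

∈-tabulate : ∀ {n} {v : Fin n} {f : Fin n → Bool} → v ∈ tabulate f → f v ≡ true
∈-tabulate {v = v} {f} v∈ = trans (sym (lookup∘tabulate f v)) (∈⇒lookup v∈)

∈-tabulate⁺ : ∀ {n} {v : Fin n} {f : Fin n → Bool} → f v ≡ true → v ∈ tabulate f
∈-tabulate⁺ {v = v} {f} fv = lookup⇒∈ (trans (lookup∘tabulate f v) fv)

∣p∣≡∑𝟙 : ∀ {n} (p : Subset n) → ∣ p ∣ ≡ ∑[ v < n ] 𝟙 (lookup p v)
∣p∣≡∑𝟙 []            = refl
∣p∣≡∑𝟙 (inside  ∷ p) = cong suc (∣p∣≡∑𝟙 p)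
∣p∣≡∑𝟙 (outside ∷ p) = ∣p∣≡∑𝟙 p

∣tabulate∣≡∑𝟙 : ∀ {n} (f : Fin n → Bool) → ∣ tabulate f ∣ ≡ ∑[ v < n ] 𝟙 (f v)
∣tabulate∣≡∑𝟙 f = trans (∣p∣≡∑𝟙 (tabulate f)) (sum-cong-≗ (λ v → cong 𝟙 (lookup∘tabulate f v)))

∑-mono-≤ : ∀ {k} {f g : Vector ℕ k} → (∀ i → f i ≤ g i) → sum f ≤ sum g
∑-mono-≤ {zero}  f≤g = z≤n
∑-mono-≤ {suc k} f≤g = +-mono-≤ (f≤g zero) (∑-mono-≤ (λ i → f≤g (suc i)))

∣p∣+∣q∣≡∑𝟙 : ∀ {n} (p q : Subset n) → ∣ p ∣ + ∣ q ∣ ≡ ∑[ v < n ] (𝟙 (lookup p v) + 𝟙 (lookup q v))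
∣p∣+∣q∣≡∑𝟙 p q = trans (cong₂ _+_ (∣p∣≡∑𝟙 p) (∣p∣≡∑𝟙 q)) (sym (∑-distrib-+ (λ v → 𝟙 (lookup p v)) (λ v → 𝟙 (lookup q v))))

∣∣-+-pointwise : ∀ {n} (p q r : Subset n) →
  (∀ v → 𝟙 (lookup p v) ≡ 𝟙 (lookup q v) + 𝟙 (lookup r v)) → ∣ p ∣ ≡ ∣ q ∣ + ∣ r ∣
∣∣-+-pointwise p q r pw = trans (∣p∣≡∑𝟙 p) (trans (sum-cong-≗ pw) (sym (∣p∣+∣q∣≡∑𝟙 q r)))

∣∪∣≡∣∣+∣∣ : ∀ {n} (p q : Subset n) → (∀ v → v ∈ p → v ∉ q) → ∣ p ∪ q ∣ ≡ ∣ p ∣ + ∣ q ∣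
∣∪∣≡∣∣+∣∣ p q disjoint = ∣∣-+-pointwise (p ∪ q) p q pointwise
  where
  pointwise : ∀ v → 𝟙 (lookup (p ∪ q) v) ≡ 𝟙 (lookup p v) + 𝟙 (lookup q v)
  pointwise v rewrite lookup-zipWith _∨_ v p q with lookup p v in ep | lookup q v in eq
  ... | true  | true  = ⊥-elim (disjoint v (lookup⇒∈ ep) (lookup⇒∈ eq))
  ... | true  | false = refl
  ... | false | _     = refl

∣∣≡∣∣+∣∣-split : ∀ {n} {p q r : Subset n} → (∀ {v} → v ∈ p → v ∈ q ⊎ v ∈ r) → q ⊆ p → r ⊆ p →
  (∀ v → v ∈ q → v ∉ r) → ∣ p ∣ ≡ ∣ q ∣ + ∣ r ∣
∣∣≡∣∣+∣∣-split {p = p} {q} {r} split q⊆p r⊆p disjoint =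
  trans (cong ∣_∣ (⊆-antisym (λ v∈p → x∈p∪q⁺ (split v∈p)) (λ v∈ → [ q⊆p , r⊆p ]′ (x∈p∪q⁻ q r v∈))))
        (∣∪∣≡∣∣+∣∣ q r disjoint)

module _ {n k : ℕ} (Vs : Fin k → Subset n) (cover : ∀ v → ∃ λ i → v ∈ Vs i)
         (disjoint : ∀ i j v → v ∈ Vs i → v ∈ Vs j → i ≡ j) where

  ∣∣≡∑∣∩blocks∣ : ∀ T → ∣ T ∣ ≡ ∑[ i < k ] ∣ T ∩ Vs i ∣
  ∣∣≡∑∣∩blocks∣ T = begin
    ∣ T ∣                                            ≡⟨ ∣p∣≡∑𝟙 T ⟩
    ∑[ v < n ] 𝟙 (lookup T v)                        ≡⟨ sum-cong-≗ count-blocks ⟩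
    ∑[ v < n ] ∑[ i < k ] 𝟙 (lookup (T ∩ Vs i) v)    ≡⟨ ∑-comm (λ v i → 𝟙 (lookup (T ∩ Vs i) v)) ⟩
    ∑[ i < k ] ∑[ v < n ] 𝟙 (lookup (T ∩ Vs i) v)    ≡⟨ sum-cong-≗ (λ i → sym (∣p∣≡∑𝟙 (T ∩ Vs i))) ⟩
    ∑[ i < k ] ∣ T ∩ Vs i ∣                          ∎
    where
    open ≡-Reasoning
    count-blocks : ∀ v → 𝟙 (lookup T v) ≡ ∑[ i < k ] 𝟙 (lookup (T ∩ Vs i) v)
    count-blocks v = trans blocks-of-v≡ (∣tabulate∣≡∑𝟙 (λ i → lookup (T ∩ Vs i) v))
      where
      blocks-of-v = tabulate λ i → lookup (T ∩ Vs i) v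
      i₀ = proj₁ (cover v)
      v∈Vs-i₀ = proj₂ (cover v)
      ∈blocks-of-v : ∀ {i} → i ∈ blocks-of-v → v ∈ T ∩ Vs i
      ∈blocks-of-v {i} i∈ = lookup⇒∈ (∈-tabulate {f = λ i → lookup (T ∩ Vs i) v} i∈)
      blocks-of-v≡ : 𝟙 (lookup T v) ≡ ∣ blocks-of-v ∣
      blocks-of-v≡ with v ∈? T
      ... | yes v∈T = trans (cong 𝟙 (∈⇒lookup v∈T)) (sym (trans (cong ∣_∣ (⊆-antisym ⊆⁅i₀⁆ ⁅i₀⁆⊆)) (∣⁅x⁆∣≡1 i₀)))
        where
        ⊆⁅i₀⁆ : blocks-of-v ⊆ ⁅ i₀ ⁆
        ⊆⁅i₀⁆ i∈ = subst (_∈ ⁅ i₀ ⁆) (sym (disjoint _ i₀ v (proj₂ (x∈p∩q⁻ T _ (∈blocks-of-v i∈))) v∈Vs-i₀)) (x∈⁅x⁆ i₀)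
        ⁅i₀⁆⊆ : ⁅ i₀ ⁆ ⊆ blocks-of-v
        ⁅i₀⁆⊆ i∈ = subst (_∈ blocks-of-v) (sym (x∈⁅y⁆⇒x≡y i₀ i∈))
                     (∈-tabulate⁺ {f = λ i → lookup (T ∩ Vs i) v} (∈⇒lookup (x∈p∩q⁺ (v∈T , v∈Vs-i₀))))
      ... | no  v∉T = trans (cong 𝟙 (∉⇒lookup v∉T))
          (sym (trans (cong ∣_∣ (⊆-antisym (λ i∈ → ⊥-elim (v∉T (proj₁ (x∈p∩q⁻ T _ (∈blocks-of-v i∈))))) ⊥⊆)) (∣⊥∣≡0 k)))

  ∣∣-mono-blocks : ∀ T R → (∀ i → ∣ T ∩ Vs i ∣ ≤ ∣ R ∩ Vs i ∣) → ∣ T ∣ ≤ ∣ R ∣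
  ∣∣-mono-blocks T R ≤-on-blocks = subst₂ _≤_ (sym (∣∣≡∑∣∩blocks∣ T)) (sym (∣∣≡∑∣∩blocks∣ R)) (∑-mono-≤ ≤-on-blocks)

  ∣∣-cong-blocks : ∀ T R → (∀ i → ∣ T ∩ Vs i ∣ ≡ ∣ R ∩ Vs i ∣) → ∣ T ∣ ≡ ∣ R ∣
  ∣∣-cong-blocks T R ≡-on-blocks = trans (∣∣≡∑∣∩blocks∣ T) (trans (sum-cong-≗ ≡-on-blocks) (sym (∣∣≡∑∣∩blocks∣ R)))

Adj : ℕ → Set
Adj n = Fin n → Fin n → Bool

_⊆ₑ_ : ∀ {n} → Adj n → Adj n → Set
adj ⊆ₑ adj' = ∀ u v → adj u v ≡ true → adj' u v ≡ true

true≢false : true ≢ false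
true≢false ()

false-if-not-true : ∀ {b} → (b ≡ true → ⊥) → b ≡ false
false-if-not-true {true}  b≢true = ⊥-elim (b≢true refl)
false-if-not-true {false} _      = refl

⊆ₑ-non-edge : ∀ {n} {adj adj' : Adj n} {u v} → adj ⊆ₑ adj' → adj' u v ≡ false → adj u v ≡ false
⊆ₑ-non-edge {u = u} {v} adj⊆adj' ¬uv = false-if-not-true λ uv → true≢false (trans (sym (adj⊆adj' u v uv)) ¬uv)

∈-allSubsets : ∀ {n} (S : Subset n) → S ∈ˡ allSubsets n
∈-allSubsets []            = here refl
∈-allSubsets (inside  ∷ S) = ∈-++⁺ˡ (∈-map⁺ (inside ∷_) (∈-allSubsets S))
∈-allSubsets {suc n} (outside ∷ S) =
  ∈-++⁺ʳ (map (inside ∷_) (allSubsets n)) (∈-map⁺ (outside ∷_) (∈-allSubsets S))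

foldr-⊔-ub : ∀ {x} {xs : List ℕ} → x ∈ˡ xs → x ≤ foldr _⊔_ 0 xs
foldr-⊔-ub {xs = y ∷ xs} (here refl) = m≤m⊔n y (foldr _⊔_ 0 xs)
foldr-⊔-ub {xs = y ∷ xs} (there x∈) = ≤-trans (foldr-⊔-ub x∈) (m≤n⊔m y (foldr _⊔_ 0 xs))

foldr-⊔-attained : ∀ (xs : List ℕ) → foldr _⊔_ 0 xs ≡ 0 ⊎ foldr _⊔_ 0 xs ∈ˡ xs
foldr-⊔-attained []       = inj₁ refl
foldr-⊔-attained (y ∷ xs) with ⊔-sel y (foldr _⊔_ 0 xs) | foldr-⊔-attained xs
... | inj₁ ≡y | _         = inj₂ (here ≡y)
... | inj₂ ≡m | inj₁ m≡0  = inj₁ (trans ≡m m≡0)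
... | inj₂ ≡m | inj₂ m∈xs = inj₂ (subst (_∈ˡ y ∷ xs) (sym ≡m) (there m∈xs))

module _ {n : ℕ} (V : Subset n) where

  stable-antitone : ∀ {adj adj' : Adj n} {S} → adj ⊆ₑ adj' → IsStable V adj' S → IsStable V adj S
  stable-antitone adj⊆adj' (S⊆V , indep) = S⊆V , λ u v u∈S v∈S → ⊆ₑ-non-edge adj⊆adj' (indep u v u∈S v∈S)

  stable⇒∣∣≤α : ∀ adj S → IsStable V adj S → ∣ S ∣ ≤ α V adj
  stable⇒∣∣≤α adj S stable = foldr-⊔-ub (∈-map⁺ ∣_∣ (∈-filter⁺ (stable? V adj) (∈-allSubsets S) stable))

  ∅-stable : ∀ adj → IsStable V adj ∅
  ∅-stable adj = (λ v∈∅ → ⊥-elim (∉⊥ v∈∅)) , (λ u v u∈∅ _ → ⊥-elim (∉⊥ u∈∅))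

  α-attained : ∀ adj → ∃ λ S → IsStable V adj S × ∣ S ∣ ≡ α V adj
  α-attained adj with foldr-⊔-attained (map ∣_∣ (filter (stable? V adj) (allSubsets n)))
  ... | inj₁ α≡0 = ∅ , ∅-stable adj , trans (∣⊥∣≡0 n) (sym α≡0)
  ... | inj₂ α∈ with ∈-map⁻ ∣_∣ α∈
  ...   | S , S∈ , α≡∣S∣ = S , proj₂ (∈-filter⁻ (stable? V adj) {xs = allSubsets n} S∈) , sym α≡∣S∣

  α≤ : ∀ adj m → (∀ S → IsStable V adj S → ∣ S ∣ ≤ m) → α V adj ≤ m
  α≤ adj m bound with α-attained adj
  ... | S , stable , ∣S∣≡α = subst (_≤ m) ∣S∣≡α (bound S stable)

  α-antitone : ∀ {adj adj' : Adj n} → adj ⊆ₑ adj' → α V adj' ≤ α V adj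
  α-antitone {adj} {adj'} adj⊆adj' =
    α≤ adj' (α V adj) λ S stable → stable⇒∣∣≤α adj S (stable-antitone adj⊆adj' stable)

  stable-restrict : ∀ {W : Subset n} {D E : Adj n} {T} → IsStable V D T →
    (∀ u v → u ∈ W → v ∈ W → E u v ≡ true → D u v ≡ true) → IsStable W E (T ∩ W)
  stable-restrict {W} {T = T} (_ , indep) E⊆D =
    (λ v∈T∩W → proj₂ (x∈p∩q⁻ T W v∈T∩W)) ,
    λ u v u∈ v∈ → let (u∈T , u∈W) = x∈p∩q⁻ T W u∈; (v∈T , v∈W) = x∈p∩q⁻ T W v∈ in
      false-if-not-true λ uv → true≢false (trans (sym (E⊆D u v u∈W v∈W uv)) (indep u v u∈T v∈T))

≟-refl : ∀ {n} (x : Fin n) → ⌊ x ≟ x ⌋ ≡ true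
≟-refl x with x ≟ x
... | yes _   = refl
... | no x≢x = ⊥-elim (x≢x refl)

samePair-true : ∀ {n} (x y u v : Fin n) → samePair x y u v ≡ true → (u ≡ x × v ≡ y) ⊎ (u ≡ y × v ≡ x)
samePair-true x y u v eq with u ≟ x | v ≟ y | u ≟ y | v ≟ x
... | yes u≡x | yes v≡y | _       | _       = inj₁ (u≡x , v≡y)
... | yes _   | no _    | yes u≡y | yes v≡x = inj₂ (u≡y , v≡x)
... | no _    | _       | yes u≡y | yes v≡x = inj₂ (u≡y , v≡x)

samePair-refl : ∀ {n} (x y : Fin n) → samePair x y x y ≡ true
samePair-refl x y rewrite ≟-refl x | ≟-refl y = refl

module _ {n : ℕ} {adj : Adj n} {x y : Fin n} where

  deleteEdge-⊆ₑ : deleteEdge adj x y ⊆ₑ adj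
  deleteEdge-⊆ₑ u v uv with adj u v
  ... | true = refl

  ⊆ₑ-addEdge : adj ⊆ₑ addEdge adj x y
  ⊆ₑ-addEdge u v uv rewrite uv = refl

  addEdge-joins : addEdge adj x y x y ≡ true
  addEdge-joins rewrite samePair-refl x y with adj x y
  ... | true  = refl
  ... | false = refl

  addEdge-stable : ∀ {V S} → IsStable V adj S → x ∉ S ⊎ y ∉ S → IsStable V (addEdge adj x y) S
  addEdge-stable {S = S} (S⊆V , indep) x∉S⊎y∉S = S⊆V , λ u v u∈S v∈S →
    false-if-not-true λ uv → not-both u∈S v∈S (new-edge (indep u v u∈S v∈S) uv) x∉S⊎y∉S
    where
    new-edge : ∀ {u v} → adj u v ≡ false → addEdge adj x y u v ≡ true → samePair x y u v ≡ true
    new-edge ¬uv uv rewrite ¬uv = uv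
    not-both : ∀ {u v} → u ∈ S → v ∈ S → samePair x y u v ≡ true → x ∉ S ⊎ y ∉ S → ⊥
    not-both {u} {v} u∈S v∈S same with samePair-true x y u v same
    ... | inj₁ (u≡x , v≡y) = [ (λ x∉S → x∉S (subst (_∈ S) u≡x u∈S)) , (λ y∉S → y∉S (subst (_∈ S) v≡y v∈S)) ]′
    ... | inj₂ (u≡y , v≡x) = [ (λ x∉S → x∉S (subst (_∈ S) v≡x v∈S)) , (λ y∉S → y∉S (subst (_∈ S) u≡y u∈S)) ]′

  deleteEdge-monotone : ∀ {adj' : Adj n} {u v} → (adj u v ≡ true → adj' u v ≡ true) →
    deleteEdge adj x y u v ≡ true → deleteEdge adj' x y u v ≡ true
  deleteEdge-monotone {adj'} {u} {v} adj⇒adj' uv with adj u v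
  ... | true rewrite adj⇒adj' refl = uv

module _ {n : ℕ} (K : Graph n) where
  open Graph K

  disjoint-maximum⇒α⁺-stable : ∀ {S T} → IsMaximumStable K S → IsMaximumStable K T →
    (∀ v → v ∈ S → v ∉ T) → α⁺-stable K
  disjoint-maximum⇒α⁺-stable {S} {T} (S-stable , ∣S∣≡α) (T-stable , ∣T∣≡α) disjoint x y _ _ _ _ =
    ≤-antisym (α-antitone V ⊆ₑ-addEdge) (≤-trans (≤-reflexive (sym ∣R∣≡α)) (stable⇒∣∣≤α V _ R R-stable))
    where
    avoiding : ∃ λ R → IsStable V (addEdge adj x y) R × ∣ R ∣ ≡ αG K
    avoiding with x ∈? S
    ... | yes x∈S = T , addEdge-stable T-stable (inj₁ (disjoint x x∈S)) , ∣T∣≡α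
    ... | no  x∉S = S , addEdge-stable S-stable (inj₁ x∉S) , ∣S∣≡α
    R = proj₁ avoiding
    R-stable = proj₁ (proj₂ avoiding)
    ∣R∣≡α = proj₂ (proj₂ avoiding)

  non-edge⇒⊆ₑdeleteEdge : ∀ {x y} → adj x y ≡ false → adj ⊆ₑ deleteEdge adj x y
  non-edge⇒⊆ₑdeleteEdge {x} {y} ¬xy u v uv with samePair x y u v in same
  ... | false rewrite uv = refl
  ... | true with samePair-true x y u v same
  ...   | inj₁ (refl , refl) = ⊥-elim (true≢false (trans (sym uv) ¬xy))
  ...   | inj₂ (refl , refl) = ⊥-elim (true≢false (trans (sym uv) (trans (adj-sym y x) ¬xy)))

  α⁻-stable⇒α-deleteEdge≡ : α⁻-stable K → ∀ x y → α V (deleteEdge adj x y) ≡ αG K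
  α⁻-stable⇒α-deleteEdge≡ α⁻ x y with adj x y in xy
  ... | true  = α⁻ x y xy
  ... | false = ≤-antisym (α-antitone V (non-edge⇒⊆ₑdeleteEdge xy)) (α-antitone V deleteEdge-⊆ₑ)

  maximumStable? : ∀ S → Dec (IsMaximumStable K S)
  maximumStable? S = stable? V adj S ×-dec (∣ S ∣ ≟ℕ αG K)

  reach⇒neighbour : ∀ {x y} → Reach K x y → y ≢ x → ∃ λ w → adj x w ≡ true
  reach⇒neighbour here           y≢x = ⊥-elim (y≢x refl)
  reach⇒neighbour (step {w = w} xw _) _ = w , xw

IsSubgraph-refl : ∀ {n} {H : Graph n} → IsSubgraph H H
IsSubgraph-refl = (λ v∈ → v∈) , λ _ _ uv → uv

IsSubgraph-trans : ∀ {n} {K H G : Graph n} → IsSubgraph K H → IsSubgraph H G → IsSubgraph K G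
IsSubgraph-trans (VK⊆VH , EK⊆EH) (VH⊆VG , EH⊆EG) = (λ v∈ → VH⊆VG (VK⊆VH v∈)) , λ u v uv → EH⊆EG u v (EK⊆EH u v uv)

stable-∩-subgraph : ∀ {n} {K G : Graph n} {T} → IsSubgraph K G →
  IsStable (Graph.V G) (Graph.adj G) T → IsStable (Graph.V K) (Graph.adj K) (T ∩ Graph.V K)
stable-∩-subgraph {G = G} K⊆G T-stable = stable-restrict (Graph.V G) T-stable λ u v _ _ uv → proj₂ K⊆G u v uv

induced : ∀ {n} → Graph n → Subset n → Graph n
induced H W = record
  { V       = W
  ; adj     = λ u v → adj u v ∧ (lookup W u ∧ lookup W v)
  ; adj-sym = λ u v → cong₂ _∧_ (adj-sym u v) (∧-comm (lookup W u) (lookup W v))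
  ; adj-irr = λ u → cong (_∧ _) (adj-irr u)
  ; adj-V   = λ u v uv → let u∈W,v∈W = ∧-conicalʳ (adj u v) _ uv in
                lookup⇒∈ (∧-conicalˡ _ _ u∈W,v∈W) , lookup⇒∈ (∧-conicalʳ _ _ u∈W,v∈W)
  }
  where open Graph H

induced-edge : ∀ {n} (H : Graph n) {W u v} → u ∈ W → v ∈ W →
  Graph.adj H u v ≡ true → Graph.adj (induced H W) u v ≡ true
induced-edge H {W} {u} {v} u∈W v∈W uv rewrite uv | ∈⇒lookup u∈W | ∈⇒lookup v∈W = refl

induced-subgraph : ∀ {n} (H : Graph n) {W} → W ⊆ Graph.V H → IsSubgraph (induced H W) H
induced-subgraph H W⊆V = W⊆V , λ u v uv → ∧-conicalˡ _ _ uv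

α-beside : ∀ {n} {V W Z : Subset n} {adj adjW : Adj n} → W ⊆ V → IsStable V adj Z →
  (∀ v → v ∈ W → v ∉ Z) → (∀ u v → u ∈ W → v ∈ Z → adj u v ≡ false × adj v u ≡ false) →
  (∀ u v → u ∈ W → v ∈ W → adj u v ≡ true → adjW u v ≡ true) →
  α W adjW + ∣ Z ∣ ≤ α V adj
α-beside {V = V} {W} {Z} {adj} {adjW} W⊆V (Z⊆V , Z-indep) W∩Z=∅ no-edges adj⊆adjW
  with α-attained W adjW
... | T , (T⊆W , T-indep) , ∣T∣≡α =
  begin
    α W adjW + ∣ Z ∣ ≡⟨ cong (_+ ∣ Z ∣) (sym ∣T∣≡α) ⟩
    ∣ T ∣ + ∣ Z ∣     ≡⟨ sym (∣∪∣≡∣∣+∣∣ T Z λ v v∈T → W∩Z=∅ v (T⊆W v∈T)) ⟩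
    ∣ T ∪ Z ∣         ≤⟨ stable⇒∣∣≤α V adj (T ∪ Z) (T∪Z⊆V , T∪Z-indep) ⟩
    α V adj           ∎
  where
  open ≤-Reasoning
  T∪Z⊆V : T ∪ Z ⊆ V
  T∪Z⊆V v∈ = [ (λ v∈T → W⊆V (T⊆W v∈T)) , Z⊆V ]′ (x∈p∪q⁻ T Z v∈)
  T∪Z-indep : ∀ u v → u ∈ T ∪ Z → v ∈ T ∪ Z → adj u v ≡ false
  T∪Z-indep u v u∈ v∈ with x∈p∪q⁻ T Z u∈ | x∈p∪q⁻ T Z v∈
  ... | inj₁ u∈T | inj₁ v∈T = false-if-not-true λ uv →
        true≢false (trans (sym (adj⊆adjW u v (T⊆W u∈T) (T⊆W v∈T) uv)) (T-indep u v u∈T v∈T))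
  ... | inj₁ u∈T | inj₂ v∈Z = proj₁ (no-edges u v (T⊆W u∈T) v∈Z)
  ... | inj₂ u∈Z | inj₁ v∈T = proj₂ (no-edges v u (T⊆W v∈T) u∈Z)
  ... | inj₂ u∈Z | inj₂ v∈Z = Z-indep u v u∈Z v∈Z

swap-bipartition : ∀ {n} {G : Graph n} {A B} → IsBipartition G A B → IsBipartition G B A
swap-bipartition (A∩B=∅ , A∪B=V , A⊆V , B⊆V , crossing) =
  (λ v v∈B v∈A → A∩B=∅ v v∈A v∈B) , (λ v v∈V → Data.Sum.swap (A∪B=V v v∈V)) , B⊆V , A⊆V ,
  λ u v uv → Data.Sum.swap (crossing u v uv)

agreeing : ∀ {n} → Subset n → Subset n → Subset n → Subset n
agreeing W S A = tabulate λ v → lookup W v ∧ (if lookup A v then lookup S v else not (lookup S v))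

record Piece {n} (G : Graph n) (A B : Subset n) (H : Graph n) : Set where
  field
    subgraph : IsSubgraph H G
    α≡∣A∩V∣  : αG H ≡ ∣ A ∩ Graph.V H ∣
    α≡∣B∩V∣  : αG H ≡ ∣ B ∩ Graph.V H ∣
    α⁻       : α⁻-stable H
    nonempty : Nonempty (Graph.V H)

Piece-swap : ∀ {n} {G H : Graph n} {A B} → Piece G A B H → Piece G B A H
Piece-swap p = record { subgraph = subgraph ; α≡∣A∩V∣ = α≡∣B∩V∣ ; α≡∣B∩V∣ = α≡∣A∩V∣ ; α⁻ = α⁻ ; nonempty = nonempty }
  where open Piece p

IsBistableBlock : ∀ {n} → Subset n → Subset n → Graph n → Set
IsBistableBlock A B K =
  IsBipartition K (A ∩ Graph.V K) (B ∩ Graph.V K) × Bistable K (A ∩ Graph.V K) (B ∩ Graph.V K) × α-stable K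

Decomposition : ∀ {n} → Subset n → Subset n → Graph n → Set
Decomposition {n} A B H = Σ ℕ λ k → 1 ≤ k × Σ (Fin k → Graph n) λ Gs →
  (∀ i → IsSubgraph (Gs i) H) ×
  (∀ i → Nonempty (Graph.V (Gs i))) ×
  (∀ v → v ∈ Graph.V H → ∃ λ i → v ∈ Graph.V (Gs i)) ×
  (∀ i j v → v ∈ Graph.V (Gs i) → v ∈ Graph.V (Gs j) → i ≡ j) ×
  (∀ i → IsBistableBlock A B (Gs i))

Decomposition-∪ : ∀ {n} {A B : Subset n} {H H₁ H₂ : Graph n} →
  IsSubgraph H₁ H → IsSubgraph H₂ H → (∀ v → v ∈ Graph.V H₁ → v ∉ Graph.V H₂) →
  (∀ v → v ∈ Graph.V H → v ∈ Graph.V H₁ ⊎ v ∈ Graph.V H₂) →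
  Decomposition A B H₁ → Decomposition A B H₂ → Decomposition A B H
Decomposition-∪ {n} {A} {B} {H} {H₁} {H₂} H₁⊆H H₂⊆H V₁∩V₂=∅ V=V₁∪V₂
  (k₁ , 1≤k₁ , Gs₁ , ⊆H₁ , nonempty₁ , cover₁ , disjoint₁ , blocks₁)
  (k₂ , _    , Gs₂ , ⊆H₂ , nonempty₂ , cover₂ , disjoint₂ , blocks₂) =
  k₁ + k₂ , ≤-trans 1≤k₁ (m≤m+n k₁ k₂) , Gs ,
  by-part (λ K → IsSubgraph K H) (λ i → IsSubgraph-trans {K = Gs₁ i} {H₁} {H} (⊆H₁ i) H₁⊆H)
                                  (λ i → IsSubgraph-trans {K = Gs₂ i} {H₂} {H} (⊆H₂ i) H₂⊆H) ,
  by-part (λ K → Nonempty (Graph.V K)) nonempty₁ nonempty₂ , cover , disjoint ,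
  by-part (IsBistableBlock A B) blocks₁ blocks₂
  where
  Gs : Fin (k₁ + k₂) → Graph n
  Gs i = [ Gs₁ , Gs₂ ]′ (splitAt k₁ i)

  by-part : (P : Graph n → Set) → (∀ i → P (Gs₁ i)) → (∀ i → P (Gs₂ i)) → ∀ i → P (Gs i)
  by-part P P₁ P₂ i with splitAt k₁ i
  ... | inj₁ i₁ = P₁ i₁
  ... | inj₂ i₂ = P₂ i₂

  cover : ∀ v → v ∈ Graph.V H → ∃ λ i → v ∈ Graph.V (Gs i)
  cover v v∈V with V=V₁∪V₂ v v∈V
  ... | inj₁ v∈V₁ = let (i , v∈) = cover₁ v v∈V₁ in
    i ↑ˡ k₂ , subst (λ K → v ∈ Graph.V K) (sym (cong [ Gs₁ , Gs₂ ]′ (Fin.splitAt-↑ˡ k₁ i k₂))) v∈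
  ... | inj₂ v∈V₂ = let (i , v∈) = cover₂ v v∈V₂ in
    k₁ ↑ʳ i , subst (λ K → v ∈ Graph.V K) (sym (cong [ Gs₁ , Gs₂ ]′ (Fin.splitAt-↑ʳ k₁ k₂ i))) v∈

  disjoint : ∀ i j v → v ∈ Graph.V (Gs i) → v ∈ Graph.V (Gs j) → i ≡ j
  disjoint i j v v∈i v∈j with splitAt k₁ i in eqi | splitAt k₁ j in eqj
  ... | inj₁ i₁ | inj₁ j₁ = trans (sym (Fin.splitAt⁻¹-↑ˡ eqi)) (trans (cong (_↑ˡ k₂) (disjoint₁ i₁ j₁ v v∈i v∈j)) (Fin.splitAt⁻¹-↑ˡ eqj))
  ... | inj₂ i₂ | inj₂ j₂ = trans (sym (Fin.splitAt⁻¹-↑ʳ eqi)) (trans (cong (k₁ ↑ʳ_) (disjoint₂ i₂ j₂ v v∈i v∈j)) (Fin.splitAt⁻¹-↑ʳ eqj))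
  ... | inj₁ i₁ | inj₂ j₂ = ⊥-elim (V₁∩V₂=∅ v (proj₁ (⊆H₁ i₁) v∈i) (proj₁ (⊆H₂ j₂) v∈j))
  ... | inj₂ i₂ | inj₁ j₁ = ⊥-elim (V₁∩V₂=∅ v (proj₁ (⊆H₁ j₁) v∈j) (proj₁ (⊆H₂ i₂) v∈i))

module Bipartite {n : ℕ} (G : Graph n) (all∈V : ∀ v → v ∈ Graph.V G) {A B : Subset n}
                 (bip : IsBipartition G A B) where
  open Graph G

  A∩B=∅ : ∀ v → v ∈ A → v ∉ B
  A∩B=∅ = proj₁ bip

  A∪B=V : ∀ v → v ∈ A ⊎ v ∈ B
  A∪B=V v = proj₁ (proj₂ bip) v (all∈V v)

  crossing : ∀ u v → adj u v ≡ true → (u ∈ A × v ∈ B) ⊎ (u ∈ B × v ∈ A)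
  crossing = proj₂ (proj₂ (proj₂ (proj₂ bip)))

  ∉A⇒∈B : ∀ {v} → v ∉ A → v ∈ B
  ∉A⇒∈B {v} v∉A = [ (λ v∈A → ⊥-elim (v∉A v∈A)) , (λ v∈B → v∈B) ]′ (A∪B=V v)

  A-neighbour∈B : ∀ {u v} → adj u v ≡ true → u ∈ A → v ∈ B
  A-neighbour∈B {u} {v} uv u∈A with crossing u v uv
  ... | inj₁ (_ , v∈B) = v∈B
  ... | inj₂ (u∈B , _) = ⊥-elim (A∩B=∅ u u∈A u∈B)

  B-neighbour∈A : ∀ {u v} → adj u v ≡ true → v ∈ B → u ∈ A
  B-neighbour∈A {u} {v} uv v∈B with crossing u v uv
  ... | inj₁ (u∈A , _) = u∈A
  ... | inj₂ (_ , v∈A) = ⊥-elim (A∩B=∅ v v∈A v∈B)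

  stable-if-crossing-pairs-nonadjacent : ∀ X →
    (∀ u v → u ∈ A → v ∈ B → u ∈ X → v ∈ X → adj u v ≡ false) → IsStable V adj X
  stable-if-crossing-pairs-nonadjacent X cross = (λ {v} _ → all∈V v) , indep
    where
    indep : ∀ u v → u ∈ X → v ∈ X → adj u v ≡ false
    indep u v u∈X v∈X = false-if-not-true λ uv → true≢false (trans (sym uv) (by-sides (crossing u v uv)))
      where
      by-sides : (u ∈ A × v ∈ B) ⊎ (u ∈ B × v ∈ A) → adj u v ≡ false
      by-sides (inj₁ (u∈A , v∈B)) = cross u v u∈A v∈B u∈X v∈X
      by-sides (inj₂ (u∈B , v∈A)) = trans (adj-sym u v) (cross v u v∈A u∈B v∈X u∈X)

  A-stable : IsStable V adj A
  A-stable = stable-if-crossing-pairs-nonadjacent A λ v w _ w∈B _ w∈A → ⊥-elim (A∩B=∅ w w∈A w∈B)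

  B-stable : IsStable V adj B
  B-stable = stable-if-crossing-pairs-nonadjacent B λ v w v∈A _ v∈B _ → ⊥-elim (A∩B=∅ v v∈A v∈B)

  restrict-bipartition : ∀ {K} → IsSubgraph K G → IsBipartition K (A ∩ Graph.V K) (B ∩ Graph.V K)
  restrict-bipartition {K} K⊆G =
    (λ v v∈A∩VK v∈B∩VK → A∩B=∅ v (proj₁ (x∈p∩q⁻ A VK v∈A∩VK)) (proj₁ (x∈p∩q⁻ B VK v∈B∩VK))) ,
    (λ v v∈VK → Data.Sum.map (λ v∈A → x∈p∩q⁺ (v∈A , v∈VK)) (λ v∈B → x∈p∩q⁺ (v∈B , v∈VK)) (A∪B=V v)) ,
    (λ v∈ → proj₂ (x∈p∩q⁻ A VK v∈)) , (λ v∈ → proj₂ (x∈p∩q⁻ B VK v∈)) ,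
    λ u v uv → let (u∈VK , v∈VK) = Graph.adj-V K u v uv in
      Data.Sum.map (λ (u∈A , v∈B) → x∈p∩q⁺ (u∈A , u∈VK) , x∈p∩q⁺ (v∈B , v∈VK))
                   (λ (u∈B , v∈A) → x∈p∩q⁺ (u∈B , u∈VK) , x∈p∩q⁺ (v∈A , v∈VK))
                   (crossing u v (proj₂ K⊆G u v uv))
    where VK = Graph.V K

  meet join : Subset n → Subset n → Fin n → Bool
  meet S T v = lookup S v ∧ lookup T v
  join S T v = lookup S v ∨ lookup T v

  meet-join join-meet : Subset n → Subset n → Subset n
  meet-join S T = tabulate λ v → if lookup A v then meet S T v else join S T v
  join-meet S T = tabulate λ v → if lookup A v then join S T v else meet S T v

  module _ {S T : Subset n} (S-max : IsMaximumStable G S) (T-max : IsMaximumStable G T) where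
    private
      S-indep = proj₂ (proj₁ S-max)
      T-indep = proj₂ (proj₁ T-max)

      ∈-A-side : ∀ {u} (f g : Fin n → Bool) → u ∈ A → u ∈ tabulate (λ v → if lookup A v then f v else g v) → f u ≡ true
      ∈-A-side {u} f g u∈A u∈ =
        subst (λ b → (if b then f u else g u) ≡ true) (∈⇒lookup u∈A) (∈-tabulate {f = λ v → if lookup A v then f v else g v} u∈)

      ∈-B-side : ∀ {u} (f g : Fin n → Bool) → u ∈ B → u ∈ tabulate (λ v → if lookup A v then f v else g v) → g u ≡ true
      ∈-B-side {u} f g u∈B u∈ =
        subst (λ b → (if b then f u else g u) ≡ true) (∉⇒lookup (λ u∈A → A∩B=∅ u u∈A u∈B))
              (∈-tabulate {f = λ v → if lookup A v then f v else g v} u∈)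

    meet-join-stable : IsStable V adj (meet-join S T)
    meet-join-stable = stable-if-crossing-pairs-nonadjacent _ λ u v u∈A v∈B u∈ v∈ →
      sides (∈-A-side (meet S T) (join S T) u∈A u∈) (∈-B-side (meet S T) (join S T) v∈B v∈)
      where
      sides : ∀ {u v} → (lookup S u ∧ lookup T u) ≡ true → (lookup S v ∨ lookup T v) ≡ true → adj u v ≡ false
      sides {u} {v} u∈S∩T v∈S∪T with lookup S u in su | lookup T u in tu | lookup S v in sv | lookup T v in tv
      ... | true | true | true | _    = S-indep u v (lookup⇒∈ su) (lookup⇒∈ sv)
      ... | true | true | false | true = T-indep u v (lookup⇒∈ tu) (lookup⇒∈ tv)

    join-meet-stable : IsStable V adj (join-meet S T)
    join-meet-stable = stable-if-crossing-pairs-nonadjacent _ λ u v u∈A v∈B u∈ v∈ →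
      sides (∈-A-side (join S T) (meet S T) u∈A u∈) (∈-B-side (join S T) (meet S T) v∈B v∈)
      where
      sides : ∀ {u v} → (lookup S u ∨ lookup T u) ≡ true → (lookup S v ∧ lookup T v) ≡ true → adj u v ≡ false
      sides {u} {v} u∈S∪T v∈S∩T with lookup S u in su | lookup T u in tu | lookup S v in sv | lookup T v in tv
      ... | true  | _    | true | true = S-indep u v (lookup⇒∈ su) (lookup⇒∈ sv)
      ... | false | true | true | true = T-indep u v (lookup⇒∈ tu) (lookup⇒∈ tv)

    ∣meet-join∣+∣join-meet∣ : ∣ meet-join S T ∣ + ∣ join-meet S T ∣ ≡ ∣ S ∣ + ∣ T ∣
    ∣meet-join∣+∣join-meet∣ =
      trans (∣p∣+∣q∣≡∑𝟙 (meet-join S T) (join-meet S T)) (trans (sum-cong-≗ pointwise) (sym (∣p∣+∣q∣≡∑𝟙 S T)))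
      where
      pointwise : ∀ v → 𝟙 (lookup (meet-join S T) v) + 𝟙 (lookup (join-meet S T) v)
                      ≡ 𝟙 (lookup S v) + 𝟙 (lookup T v)
      pointwise v rewrite lookup∘tabulate (λ v → if lookup A v then meet S T v else join S T v) v
                        | lookup∘tabulate (λ v → if lookup A v then join S T v else meet S T v) v
        with lookup A v | lookup S v | lookup T v
      ... | true  | true  | true  = refl
      ... | true  | true  | false = refl
      ... | true  | false | _     = refl
      ... | false | true  | true  = refl
      ... | false | true  | false = refl
      ... | false | false | true  = refl
      ... | false | false | false = refl

    meet-join-maximum : IsMaximumStable G (meet-join S T)
    meet-join-maximum = meet-join-stable ,
      m+n≡o+o⇒m≡o (trans ∣meet-join∣+∣join-meet∣ (cong₂ _+_ (proj₂ S-max) (proj₂ T-max)))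
        (stable⇒∣∣≤α V adj _ meet-join-stable) (stable⇒∣∣≤α V adj _ join-meet-stable)
      where
      m+n≡o+o⇒m≡o : ∀ {m k o} → m + k ≡ o + o → m ≤ o → k ≤ o → m ≡ o
      m+n≡o+o⇒m≡o {m} {k} {o} eq m≤o k≤o =
        ≤-antisym m≤o (+-cancelʳ-≤ o o m (≤-trans (≤-reflexive (sym eq)) (+-monoʳ-≤ m k≤o)))

    meet-join-shrinks : ∀ {x} → x ∈ S → x ∈ A → x ∉ T → meet-join S T ∩ A ⊂ S ∩ A
    meet-join-shrinks {x} x∈S x∈A x∉T = ⊆ , x , x∈p∩q⁺ (x∈S , x∈A) , x∉
      where
      ⊆ : meet-join S T ∩ A ⊆ S ∩ A
      ⊆ {v} v∈ = let (v∈U , v∈A) = x∈p∩q⁻ (meet-join S T) A v∈ in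
        x∈p∩q⁺ (lookup⇒∈ (∧-conicalˡ _ _ (∈-A-side (meet S T) (join S T) v∈A v∈U)) , v∈A)
      x∉ : x ∉ meet-join S T ∩ A
      x∉ x∈ = true≢false (trans (sym (∧-conicalʳ _ _ (∈-A-side (meet S T) (join S T) x∈A (proj₁ (x∈p∩q⁻ (meet-join S T) A x∈)))))
                                (∉⇒lookup x∉T))

  minimal-maximum-stable : ∃ λ S → IsMaximumStable G S × (∀ T → IsMaximumStable G T → S ∩ A ⊆ T)
  minimal-maximum-stable with α-attained V adj
  ... | S , S-stable , ∣S∣≡α = descend S (<-wellFounded ∣ S ∩ A ∣) (S-stable , ∣S∣≡α)
    where
    descend : ∀ S → Acc _<_ ∣ S ∩ A ∣ → IsMaximumStable G S →
              ∃ λ S → IsMaximumStable G S × (∀ T → IsMaximumStable G T → S ∩ A ⊆ T)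
    descend S (acc smaller) S-max
      with anySubset? (λ T → maximumStable? G T ×-dec (∣ meet-join S T ∩ A ∣ <? ∣ S ∩ A ∣))
    ... | yes (T , T-max , shrinks) = descend (meet-join S T) (smaller shrinks) (meet-join-maximum S-max T-max)
    ... | no none = S , S-max , λ T T-max {x} x∈S∩A → let (x∈S , x∈A) = x∈p∩q⁻ S A x∈S∩A in
          decidable-stable (x ∈? T) λ x∉T →
            none (T , T-max , p⊂q⇒∣p∣<∣q∣ (meet-join-shrinks S-max T-max x∈S x∈A x∉T))

  α⁺-stable⇒∩A-subsingleton : α⁺-stable G → ∀ {S} → IsStable V adj S →
    (∀ T → IsMaximumStable G T → S ∩ A ⊆ T) → ∀ {x y} → x ∈ S ∩ A → y ∈ S ∩ A → x ≡ y
  α⁺-stable⇒∩A-subsingleton α⁺ {S} (_ , S-indep) S∩A⊆maximum {x} {y} x∈ y∈ =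
    decidable-stable (x ≟ y) λ x≢y →
      let (T , T-stable⁺ , ∣T∣≡α⁺) = α-attained V (addEdge adj x y)
          T-max : IsMaximumStable G T
          T-max = stable-antitone V ⊆ₑ-addEdge T-stable⁺ ,
                  trans ∣T∣≡α⁺ (α⁺ x y (all∈V x) (all∈V y) x≢y
                                  (S-indep x y (proj₁ (x∈p∩q⁻ S A x∈)) (proj₁ (x∈p∩q⁻ S A y∈))))
      in true≢false (trans (sym (addEdge-joins {adj = adj} {x} {y}))
                           (proj₂ T-stable⁺ x y (S∩A⊆maximum T T-max x∈) (S∩A⊆maximum T T-max y∈)))

  ∩A-subsingleton⇒∣∣≤∣B∣ : (∀ x → ∃ λ w → adj x w ≡ true) → ∀ {S} → IsStable V adj S →
    (∀ {x y} → x ∈ S ∩ A → y ∈ S ∩ A → x ≡ y) → ∣ S ∣ ≤ ∣ B ∣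
  ∩A-subsingleton⇒∣∣≤∣B∣ has-neighbour {S} (_ , S-indep) S∩A-subsingleton with nonempty? (S ∩ A)
  ... | no S∩A=∅ = p⊆q⇒∣p∣≤∣q∣ λ {v} v∈S → ∉A⇒∈B λ v∈A → S∩A=∅ (v , x∈p∩q⁺ (v∈S , v∈A))
  ... | yes (x , x∈S∩A) = +-cancelʳ-≤ 1 (∣ S ∣) (∣ B ∣) (begin
    ∣ S ∣ + 1          ≡⟨ cong (∣ S ∣ +_) (sym (∣⁅x⁆∣≡1 w)) ⟩
    ∣ S ∣ + ∣ ⁅ w ⁆ ∣  ≡⟨ sym (∣∪∣≡∣∣+∣∣ S ⁅ w ⁆ λ v v∈S v∈⁅w⁆ → w∉S (subst (_∈ S) (x∈⁅y⁆⇒x≡y w v∈⁅w⁆) v∈S)) ⟩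
    ∣ S ∪ ⁅ w ⁆ ∣      ≤⟨ p⊆q⇒∣p∣≤∣q∣ S∪w⊆B∪x ⟩
    ∣ B ∪ ⁅ x ⁆ ∣      ≡⟨ ∣∪∣≡∣∣+∣∣ B ⁅ x ⁆ (λ v v∈B v∈⁅x⁆ → A∩B=∅ v (subst (_∈ A) (sym (x∈⁅y⁆⇒x≡y x v∈⁅x⁆)) x∈A) v∈B) ⟩
    ∣ B ∣ + ∣ ⁅ x ⁆ ∣  ≡⟨ cong (∣ B ∣ +_) (∣⁅x⁆∣≡1 x) ⟩
    ∣ B ∣ + 1          ∎)
    where
    open ≤-Reasoning
    x∈S = proj₁ (x∈p∩q⁻ S A x∈S∩A)
    x∈A = proj₂ (x∈p∩q⁻ S A x∈S∩A)
    w = proj₁ (has-neighbour x)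
    xw = proj₂ (has-neighbour x)
    w∉S : w ∉ S
    w∉S w∈S = true≢false (trans (sym xw) (S-indep x w x∈S w∈S))
    S∪w⊆B∪x : S ∪ ⁅ w ⁆ ⊆ B ∪ ⁅ x ⁆
    S∪w⊆B∪x {v} v∈ with x∈p∪q⁻ S ⁅ w ⁆ v∈ | v ∈? A
    ... | inj₁ v∈S | yes v∈A = x∈p∪q⁺ (inj₂ (subst (_∈ ⁅ x ⁆) (sym (S∩A-subsingleton (x∈p∩q⁺ (v∈S , v∈A)) x∈S∩A)) (x∈⁅x⁆ x)))
    ... | inj₁ v∈S | no  v∉A = x∈p∪q⁺ (inj₁ (∉A⇒∈B v∉A))
    ... | inj₂ v∈⁅w⁆ | _     = x∈p∪q⁺ (inj₁ (subst (_∈ B) (sym (x∈⁅y⁆⇒x≡y w v∈⁅w⁆)) (A-neighbour∈B xw x∈A)))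

  α⁺-stable⇒α≤∣B∣ : α⁺-stable G → (∀ x → ∃ λ w → adj x w ≡ true) → αG G ≤ ∣ B ∣
  α⁺-stable⇒α≤∣B∣ α⁺ has-neighbour with minimal-maximum-stable
  ... | S , (S-stable , ∣S∣≡α) , S∩A⊆maximum = subst (_≤ ∣ B ∣) ∣S∣≡α
    (∩A-subsingleton⇒∣∣≤∣B∣ has-neighbour S-stable (α⁺-stable⇒∩A-subsingleton α⁺ S-stable S∩A⊆maximum))

  module Agreeing (W S : Subset n) where
    private
      agrees : Fin n → Bool
      agrees v = if lookup A v then lookup S v else not (lookup S v)

      ∈agreeing⇒agrees : ∀ {v} → v ∈ agreeing W S A → agrees v ≡ true
      ∈agreeing⇒agrees v∈ = ∧-conicalʳ _ _ (∈-tabulate {f = λ v → lookup W v ∧ agrees v} v∈)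

      agrees⇒∈agreeing : ∀ {v} → v ∈ W → agrees v ≡ true → v ∈ agreeing W S A
      agrees⇒∈agreeing {v} v∈W agrees-v =
        ∈-tabulate⁺ {f = λ v → lookup W v ∧ agrees v} (subst (λ b → (b ∧ agrees v) ≡ true) (sym (∈⇒lookup v∈W)) agrees-v)

      ∈B⇒lookup-A≡false : ∀ {v} → v ∈ B → lookup A v ≡ false
      ∈B⇒lookup-A≡false {v} v∈B = ∉⇒lookup λ v∈A → A∩B=∅ v v∈A v∈B

    agreeing⊆ : agreeing W S A ⊆ W
    agreeing⊆ {v} v∈ = lookup⇒∈ (∧-conicalˡ _ _ (∈-tabulate {f = λ v → lookup W v ∧ agrees v} v∈))

    agreeing∩A⊆S : ∀ {v} → v ∈ agreeing W S A → v ∈ A → v ∈ S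
    agreeing∩A⊆S {v} v∈ v∈A = lookup⇒∈ (subst (λ b → (if b then lookup S v else not (lookup S v)) ≡ true)
                                               (∈⇒lookup v∈A) (∈agreeing⇒agrees v∈))

    agreeing∩B∩S=∅ : ∀ {v} → v ∈ agreeing W S A → v ∈ B → v ∉ S
    agreeing∩B∩S=∅ {v} v∈ v∈B v∈S = true≢false (begin
      true                                                     ≡⟨ sym (∈agreeing⇒agrees v∈) ⟩
      (if lookup A v then lookup S v else not (lookup S v))   ≡⟨ cong (λ b → if b then lookup S v else not (lookup S v)) (∈B⇒lookup-A≡false v∈B) ⟩
      not (lookup S v)                                         ≡⟨ cong not (∈⇒lookup v∈S) ⟩
      false                                                    ∎)
      where open ≡-Reasoning

    W∩A∩S⊆agreeing : ∀ {v} → v ∈ W → v ∈ A → v ∈ S → v ∈ agreeing W S A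
    W∩A∩S⊆agreeing {v} v∈W v∈A v∈S = agrees⇒∈agreeing v∈W
      (subst (λ b → (if b then lookup S v else not (lookup S v)) ≡ true) (sym (∈⇒lookup v∈A)) (∈⇒lookup v∈S))

    W∩B∖S⊆agreeing : ∀ {v} → v ∈ W → v ∈ B → v ∉ S → v ∈ agreeing W S A
    W∩B∖S⊆agreeing {v} v∈W v∈B v∉S = agrees⇒∈agreeing v∈W
      (subst (λ b → (if b then lookup S v else not (lookup S v)) ≡ true) (sym (∈B⇒lookup-A≡false v∈B))
             (cong not (∉⇒lookup v∉S)))

  -- W = (S ∩ A) ∪ (B ∖ S) has no neighbours in Z = S ∩ B, so stable sets of H[W] extend by Z.
  module Split {H : Graph n} (piece : Piece G A B H) {S : Subset n} (S-max : IsMaximumStable H S) where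
    open Graph H using () renaming (V to VH; adj to adjH)
    open Agreeing VH S
    private
      S⊆VH = proj₁ (proj₁ S-max)
      S-indep = proj₂ (proj₁ S-max)
      ∣S∣≡α = proj₂ S-max

    W Z : Subset n
    W = agreeing VH S A
    Z = S ∩ B

    Z-stable : IsStable VH adjH Z
    Z-stable = (λ v∈Z → S⊆VH (proj₁ (x∈p∩q⁻ S B v∈Z))) ,
               λ u v u∈Z v∈Z → S-indep u v (proj₁ (x∈p∩q⁻ S B u∈Z)) (proj₁ (x∈p∩q⁻ S B v∈Z))

    W∩Z=∅ : ∀ v → v ∈ W → v ∉ Z
    W∩Z=∅ v v∈W v∈Z = agreeing∩B∩S=∅ v∈W (proj₂ (x∈p∩q⁻ S B v∈Z)) (proj₁ (x∈p∩q⁻ S B v∈Z))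

    -- A neighbour of Z ⊆ B lies in A, so if it is in W it is in S.
    W-Z-non-adjacent : ∀ u v → u ∈ W → v ∈ Z → adjH u v ≡ false
    W-Z-non-adjacent u v u∈W v∈Z = false-if-not-true λ uv →
      let (v∈S , v∈B) = x∈p∩q⁻ S B v∈Z
          u∈S = agreeing∩A⊆S u∈W (B-neighbour∈A (proj₂ (Piece.subgraph piece) u v uv) v∈B)
      in true≢false (trans (sym uv) (S-indep u v u∈S v∈S))

    ∣S∣≡∣A∩W∣+∣Z∣ : ∣ S ∣ ≡ ∣ A ∩ W ∣ + ∣ Z ∣
    ∣S∣≡∣A∩W∣+∣Z∣ = ∣∣≡∣∣+∣∣-split
      (λ {v} v∈S → Data.Sum.map (λ v∈A → x∈p∩q⁺ (v∈A , W∩A∩S⊆agreeing (S⊆VH v∈S) v∈A v∈S))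
                                (λ v∈B → x∈p∩q⁺ (v∈S , v∈B)) (A∪B=V v))
      (λ v∈A∩W → let (v∈A , v∈W) = x∈p∩q⁻ A W v∈A∩W in agreeing∩A⊆S v∈W v∈A)
      (λ v∈Z → proj₁ (x∈p∩q⁻ S B v∈Z))
      (λ v v∈A∩W v∈Z → A∩B=∅ v (proj₁ (x∈p∩q⁻ A W v∈A∩W)) (proj₂ (x∈p∩q⁻ S B v∈Z)))

    ∣B∩VH∣≡∣B∩W∣+∣Z∣ : ∣ B ∩ VH ∣ ≡ ∣ B ∩ W ∣ + ∣ Z ∣
    ∣B∩VH∣≡∣B∩W∣+∣Z∣ = ∣∣≡∣∣+∣∣-split
      (λ {v} v∈ → let (v∈B , v∈VH) = x∈p∩q⁻ B VH v∈ in case v ∈? S of λ where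
         (yes v∈S) → inj₂ (x∈p∩q⁺ (v∈S , v∈B))
         (no  v∉S) → inj₁ (x∈p∩q⁺ (v∈B , W∩B∖S⊆agreeing v∈VH v∈B v∉S)))
      (λ v∈B∩W → let (v∈B , v∈W) = x∈p∩q⁻ B W v∈B∩W in x∈p∩q⁺ (v∈B , agreeing⊆ v∈W))
      (λ v∈Z → let (v∈S , v∈B) = x∈p∩q⁻ S B v∈Z in x∈p∩q⁺ (v∈B , S⊆VH v∈S))
      (λ v v∈B∩W v∈Z → W∩Z=∅ v (proj₂ (x∈p∩q⁻ B W v∈B∩W)) v∈Z)

    ∣A∩W∣≡∣B∩W∣ : ∣ A ∩ W ∣ ≡ ∣ B ∩ W ∣
    ∣A∩W∣≡∣B∩W∣ = +-cancelʳ-≡ (∣ Z ∣) (∣ A ∩ W ∣) (∣ B ∩ W ∣) (begin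
      ∣ A ∩ W ∣ + ∣ Z ∣  ≡⟨ sym ∣S∣≡∣A∩W∣+∣Z∣ ⟩
      ∣ S ∣              ≡⟨ ∣S∣≡α ⟩
      αG H               ≡⟨ Piece.α≡∣B∩V∣ piece ⟩
      ∣ B ∩ VH ∣         ≡⟨ ∣B∩VH∣≡∣B∩W∣+∣Z∣ ⟩
      ∣ B ∩ W ∣ + ∣ Z ∣  ∎)
      where open ≡-Reasoning

    α-on-W≤∣A∩W∣ : ∀ {D E : Adj n} → D ⊆ₑ adjH → (∀ u v → u ∈ W → v ∈ W → D u v ≡ true → E u v ≡ true) →
      α VH D ≡ αG H → α W E ≤ ∣ A ∩ W ∣
    α-on-W≤∣A∩W∣ {D} {E} D⊆adjH D⊆E αD≡α = +-cancelʳ-≤ (∣ Z ∣) (α W E) (∣ A ∩ W ∣) (begin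
      α W E + ∣ Z ∣      ≤⟨ α-beside agreeing⊆ (stable-antitone VH D⊆adjH Z-stable) W∩Z=∅ no-edges D⊆E ⟩
      α VH D             ≡⟨ αD≡α ⟩
      αG H               ≡⟨ sym ∣S∣≡α ⟩
      ∣ S ∣              ≡⟨ ∣S∣≡∣A∩W∣+∣Z∣ ⟩
      ∣ A ∩ W ∣ + ∣ Z ∣  ∎)
      where
      open ≤-Reasoning
      no-edges : ∀ u v → u ∈ W → v ∈ Z → D u v ≡ false × D v u ≡ false
      no-edges u v u∈W v∈Z =
        ⊆ₑ-non-edge D⊆adjH (W-Z-non-adjacent u v u∈W v∈Z) ,
        ⊆ₑ-non-edge D⊆adjH (trans (Graph.adj-sym H v u) (W-Z-non-adjacent u v u∈W v∈Z))

    W-nonempty : S ≢ B ∩ VH → Nonempty W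
    W-nonempty S≢B∩VH with nonempty? W
    ... | yes W≠∅ = W≠∅
    ... | no  W=∅ = ⊥-elim (S≢B∩VH (⊆-antisym S⊆B∩VH B∩VH⊆S))
      where
      S⊆B∩VH : S ⊆ B ∩ VH
      S⊆B∩VH {v} v∈S = x∈p∩q⁺ (∉A⇒∈B (λ v∈A → W=∅ (v , W∩A∩S⊆agreeing (S⊆VH v∈S) v∈A v∈S)) , S⊆VH v∈S)
      B∩VH⊆S : B ∩ VH ⊆ S
      B∩VH⊆S {v} v∈ = let (v∈B , v∈VH) = x∈p∩q⁻ B VH v∈ in
        decidable-stable (v ∈? S) λ v∉S → W=∅ (v , W∩B∖S⊆agreeing v∈VH v∈B v∉S)

  agreeing-piece : ∀ {H S} → Piece G A B H → IsMaximumStable H S → S ≢ B ∩ Graph.V H →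
    Piece G A B (induced H (agreeing (Graph.V H) S A))
  agreeing-piece {H} {S} piece S-max S≢B∩VH = record
    { subgraph = K⊆G
    ; α≡∣A∩V∣  = α≡∣A∩W∣
    ; α≡∣B∩V∣  = trans α≡∣A∩W∣ ∣A∩W∣≡∣B∩W∣
    ; α⁻       = λ x y _ → ≤-antisym
        (≤-trans (α-on-W≤∣A∩W∣ deleteEdge-⊆ₑ
                   (λ u v u∈W v∈W → deleteEdge-monotone {adj = Graph.adj H} {x} {y} {Graph.adj K} (induced-edge H u∈W v∈W))
                   (α⁻-stable⇒α-deleteEdge≡ H (Piece.α⁻ piece) x y))
                 (≤-reflexive (sym α≡∣A∩W∣)))
        (α-antitone W deleteEdge-⊆ₑ)
    ; nonempty = W-nonempty S≢B∩VH
    }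
    where
    open Split piece S-max
    K = induced H W

    K⊆G : IsSubgraph K G
    K⊆G = IsSubgraph-trans {K = K} {H} {G} (induced-subgraph H (Agreeing.agreeing⊆ (Graph.V H) S)) (Piece.subgraph piece)

    α≡∣A∩W∣ : αG K ≡ ∣ A ∩ W ∣
    α≡∣A∩W∣ = ≤-antisym (α-on-W≤∣A∩W∣ (λ _ _ uv → uv) (λ u v u∈W v∈W → induced-edge H u∈W v∈W) refl)
                        (stable⇒∣∣≤α W (Graph.adj K) (A ∩ W) (stable-∩-subgraph {K = K} {G} K⊆G A-stable))

  piece-bistable-block : ∀ {H} → Piece G A B H →
    (∀ S → IsMaximumStable H S → S ≡ A ∩ Graph.V H ⊎ S ≡ B ∩ Graph.V H) → IsBistableBlock A B H
  piece-bistable-block {H} piece only-sides =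
    H-bipartition , (A∩V-max , B∩V-max , A∩V≢B∩V , only-sides) ,
    disjoint-maximum⇒α⁺-stable H A∩V-max B∩V-max A∩V∩B∩V=∅ , α⁻
    where
    open Piece piece
    VH = Graph.V H
    H-bipartition : IsBipartition H (A ∩ VH) (B ∩ VH)
    H-bipartition = restrict-bipartition {H} subgraph
    A∩V-max : IsMaximumStable H (A ∩ VH)
    A∩V-max = stable-∩-subgraph {K = H} {G} subgraph A-stable , sym α≡∣A∩V∣
    B∩V-max : IsMaximumStable H (B ∩ VH)
    B∩V-max = stable-∩-subgraph {K = H} {G} subgraph B-stable , sym α≡∣B∩V∣
    A∩V∩B∩V=∅ : ∀ v → v ∈ A ∩ VH → v ∉ B ∩ VH
    A∩V∩B∩V=∅ = proj₁ H-bipartition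
    A∩V≢B∩V : A ∩ VH ≢ B ∩ VH
    A∩V≢B∩V A∩V≡B∩V =
      [ (λ v∈A∩V → A∩V∩B∩V=∅ v v∈A∩V (subst (v ∈_) A∩V≡B∩V v∈A∩V)) ,
        (λ v∈B∩V → A∩V∩B∩V=∅ v (subst (v ∈_) (sym A∩V≡B∩V) v∈B∩V) v∈B∩V) ]′
      (proj₁ (proj₂ H-bipartition) v v∈V)
      where
      v = proj₁ nonempty
      v∈V = proj₂ nonempty

module Decompose {n : ℕ} (G : Graph n) (all∈V : ∀ v → v ∈ Graph.V G) {A B : Subset n}
                 (bip : IsBipartition G A B) where
  private
    module AB = Bipartite G all∈V bip
    module BA = Bipartite G all∈V (swap-bipartition {G = G} bip)

  _≟ˢ_ : (p q : Subset n) → Dec (p ≡ q)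
  _≟ˢ_ = ≡-dec _≟ᵇ_

  agreeing-disjoint : ∀ W S v → v ∈ agreeing W S A → v ∉ agreeing W S B
  agreeing-disjoint W S v v∈W₁ v∈W₂ with AB.A∪B=V v
  ... | inj₁ v∈A = BA.Agreeing.agreeing∩B∩S=∅ W S v∈W₂ v∈A (AB.Agreeing.agreeing∩A⊆S W S v∈W₁ v∈A)
  ... | inj₂ v∈B = AB.Agreeing.agreeing∩B∩S=∅ W S v∈W₁ v∈B (BA.Agreeing.agreeing∩A⊆S W S v∈W₂ v∈B)

  agreeing-cover : ∀ W S v → v ∈ W → v ∈ agreeing W S A ⊎ v ∈ agreeing W S B
  agreeing-cover W S v v∈W with AB.A∪B=V v | v ∈? S
  ... | inj₁ v∈A | yes v∈S = inj₁ (AB.Agreeing.W∩A∩S⊆agreeing W S v∈W v∈A v∈S)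
  ... | inj₁ v∈A | no  v∉S = inj₂ (BA.Agreeing.W∩B∖S⊆agreeing W S v∈W v∈A v∉S)
  ... | inj₂ v∈B | yes v∈S = inj₂ (BA.Agreeing.W∩A∩S⊆agreeing W S v∈W v∈B v∈S)
  ... | inj₂ v∈B | no  v∉S = inj₁ (AB.Agreeing.W∩B∖S⊆agreeing W S v∈W v∈B v∉S)

  decompose : ∀ H → Acc _<_ ∣ Graph.V H ∣ → Piece G A B H → Decomposition A B H
  decompose H (acc smaller) piece
    with anySubset? (λ S → maximumStable? H S ×-dec (¬? (S ≟ˢ (A ∩ Graph.V H)) ×-dec ¬? (S ≟ˢ (B ∩ Graph.V H))))
  ... | no none =
    1 , ≤-refl , (λ _ → H) , (λ _ → IsSubgraph-refl {H = H}) , (λ _ → Piece.nonempty piece) , (λ v v∈ → zero , v∈) ,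
    (λ { zero zero _ _ _ → refl }) , λ _ → AB.piece-bistable-block piece only-sides
    where
    only-sides : ∀ S → IsMaximumStable H S → S ≡ A ∩ Graph.V H ⊎ S ≡ B ∩ Graph.V H
    only-sides S S-max with S ≟ˢ (A ∩ Graph.V H) | S ≟ˢ (B ∩ Graph.V H)
    ... | yes S≡A | _       = inj₁ S≡A
    ... | no  _   | yes S≡B = inj₂ S≡B
    ... | no  S≢A | no  S≢B = ⊥-elim (none (S , S-max , S≢A , S≢B))
  ... | yes (S , S-max , S≢A , S≢B) =
    Decomposition-∪ {H = H} {H₁} {H₂} (induced-subgraph H W₁⊆V) (induced-subgraph H W₂⊆V) W₁∩W₂=∅ (agreeing-cover VH S)
      (decompose H₁ (smaller W₁⊂V) piece₁)
      (decompose H₂ (smaller W₂⊂V) piece₂)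
    where
    VH = Graph.V H
    W₁ = agreeing VH S A
    W₂ = agreeing VH S B
    H₁ = induced H W₁
    H₂ = induced H W₂
    W₁⊆V = AB.Agreeing.agreeing⊆ VH S
    W₂⊆V = BA.Agreeing.agreeing⊆ VH S
    W₁∩W₂=∅ = agreeing-disjoint VH S

    piece₁ : Piece G A B H₁
    piece₁ = AB.agreeing-piece piece S-max S≢B
    piece₂ : Piece G A B H₂
    piece₂ = Piece-swap (BA.agreeing-piece (Piece-swap piece) S-max S≢A)

    W₁⊂V : ∣ W₁ ∣ < ∣ VH ∣
    W₁⊂V = let (v , v∈W₂) = Piece.nonempty piece₂ in
      p⊂q⇒∣p∣<∣q∣ (W₁⊆V , v , W₂⊆V v∈W₂ , λ v∈W₁ → W₁∩W₂=∅ v v∈W₁ v∈W₂)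
    W₂⊂V : ∣ W₂ ∣ < ∣ VH ∣
    W₂⊂V = let (v , v∈W₁) = Piece.nonempty piece₁ in
      p⊂q⇒∣p∣<∣q∣ (W₂⊆V , v , W₁⊆V v∈W₁ , λ v∈W₂ → W₁∩W₂=∅ v v∈W₁ v∈W₂)

  α-stable⇒decomposition : α-stable G → (∀ x → ∃ λ w → Graph.adj G x w ≡ true) → Nonempty (Graph.V G) →
    Decomposition A B G
  α-stable⇒decomposition (α⁺ , α⁻) has-neighbour V≠∅ = decompose G (<-wellFounded _) record
    { subgraph = IsSubgraph-refl {H = G}
    ; α≡∣A∩V∣  = trans (≤-antisym (BA.α⁺-stable⇒α≤∣B∣ α⁺ has-neighbour) (stable⇒∣∣≤α V adj A AB.A-stable)) (sym (∣∩V∣≡∣∣ A))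
    ; α≡∣B∩V∣  = trans (≤-antisym (AB.α⁺-stable⇒α≤∣B∣ α⁺ has-neighbour) (stable⇒∣∣≤α V adj B AB.B-stable)) (sym (∣∩V∣≡∣∣ B))
    ; α⁻       = α⁻
    ; nonempty = V≠∅
    }
    where
    open Graph G
    ∣∩V∣≡∣∣ : ∀ R → ∣ R ∩ V ∣ ≡ ∣ R ∣
    ∣∩V∣≡∣∣ R = cong ∣_∣ (⊆-antisym (p∩q⊆p R V) λ v∈R → x∈p∩q⁺ (v∈R , all∈V _))

connected⇒no-isolated-vertex : ∀ {n} (G : Graph n) → (∀ v → v ∈ Graph.V G) → Connected G →
  (∀ x → ∃ λ y → y ≢ x) → ∀ x → ∃ λ w → Graph.adj G x w ≡ true
connected⇒no-isolated-vertex G all∈V connected another x =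
  reach⇒neighbour G (connected x y (all∈V x) (all∈V y)) y≢x
  where
  y = proj₁ (another x)
  y≢x = proj₂ (another x)

module _ {n k : ℕ} (G : Graph n) (all∈V : ∀ v → v ∈ Graph.V G) {A B : Subset n} (bip : IsBipartition G A B)
         (Gs : Fin k → Graph n) (Gs⊆G : ∀ i → IsSubgraph (Gs i) G)
         (cover : ∀ v → ∃ λ i → v ∈ Graph.V (Gs i))
         (disjoint : ∀ i j v → v ∈ Graph.V (Gs i) → v ∈ Graph.V (Gs j) → i ≡ j)
         (blocks : ∀ i → IsBistableBlock A B (Gs i)) where
  open Graph G
  open Bipartite G all∈V bip using (A∩B=∅; A-stable; B-stable)
  private
    Vs : Fin k → Subset n
    Vs i = Graph.V (Gs i)

    α-block≡∣A∩V∣ : ∀ i → αG (Gs i) ≡ ∣ A ∩ Vs i ∣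
    α-block≡∣A∩V∣ i = sym (proj₂ (proj₁ (proj₁ (proj₂ (blocks i)))))

    α-block≡∣B∩V∣ : ∀ i → αG (Gs i) ≡ ∣ B ∩ Vs i ∣
    α-block≡∣B∩V∣ i = sym (proj₂ (proj₁ (proj₂ (proj₁ (proj₂ (blocks i))))))

    α≤∣A∣ : ∀ {D : Adj n} (Ds : Fin k → Adj n) → (∀ i → α (Vs i) (Ds i) ≡ ∣ A ∩ Vs i ∣) →
      (∀ i u v → Ds i u v ≡ true → D u v ≡ true) → α V D ≤ ∣ A ∣
    α≤∣A∣ {D} Ds α≡ Ds⊆D = α≤ V D ∣ A ∣ λ T T-stable → ∣∣-mono-blocks Vs cover disjoint T A λ i →
      subst (∣ T ∩ Vs i ∣ ≤_) (α≡ i) (stable⇒∣∣≤α (Vs i) (Ds i) (T ∩ Vs i)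
                                       (stable-restrict V T-stable λ u v _ _ → Ds⊆D i u v))

    α≡∣A∣ : αG G ≡ ∣ A ∣
    α≡∣A∣ = ≤-antisym (α≤∣A∣ (λ i → Graph.adj (Gs i)) α-block≡∣A∩V∣ (λ i → proj₂ (Gs⊆G i)))
                      (stable⇒∣∣≤α V adj A A-stable)

    ∣A∣≡∣B∣ : ∣ A ∣ ≡ ∣ B ∣
    ∣A∣≡∣B∣ = ∣∣-cong-blocks Vs cover disjoint A B λ i → trans (sym (α-block≡∣A∩V∣ i)) (α-block≡∣B∩V∣ i)

  bistable-blocks⇒α-stable : α-stable G
  bistable-blocks⇒α-stable = α⁺ , α⁻
    where
    α⁺ : α⁺-stable G
    α⁺ = disjoint-maximum⇒α⁺-stable G (A-stable , sym α≡∣A∣) (B-stable , sym (trans α≡∣A∣ ∣A∣≡∣B∣)) A∩B=∅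
    α⁻ : α⁻-stable G
    α⁻ x y _ = ≤-antisym
      (≤-trans (α≤∣A∣ (λ i → deleteEdge (Graph.adj (Gs i)) x y)
                      (λ i → trans (α⁻-stable⇒α-deleteEdge≡ (Gs i) (proj₂ (proj₂ (proj₂ (blocks i)))) x y) (α-block≡∣A∩V∣ i))
                      (λ i u v → deleteEdge-monotone {adj = Graph.adj (Gs i)} {x} {y} {adj} (proj₂ (Gs⊆G i) u v)))
               (≤-reflexive (sym α≡∣A∣)))
      (α-antitone V deleteEdge-⊆ₑ)

BistablePartition : ∀ {n} → Graph n → Subset n → Subset n → Set
BistablePartition {n} G A B = Σ ℕ λ k → 1 ≤ k × Σ (Fin k → Graph n) λ Gs →
  (∀ i → IsSubgraph (Gs i) G) ×
  (∀ i → Nonempty (Graph.V (Gs i))) ×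
  (∀ v → ∃ λ i → v ∈ Graph.V (Gs i)) ×
  (∀ i j v → v ∈ Graph.V (Gs i) → v ∈ Graph.V (Gs j) → i ≡ j) ×
  (∀ i → IsBistableBlock A B (Gs i))

decomposition⇒bistable-partition : ∀ {n} {G : Graph n} {A B} → (∀ v → v ∈ Graph.V G) →
  Decomposition A B G → BistablePartition G A B
decomposition⇒bistable-partition all∈V (k , 1≤k , Gs , Gs⊆G , nonempty , cover , disjoint , blocks) =
  k , 1≤k , Gs , Gs⊆G , nonempty , (λ v → cover v (all∈V v)) , disjoint , blocks

another-vertex : ∀ {n} (x : Fin (suc (suc n))) → ∃ λ y → y ≢ x
another-vertex zero    = suc zero , λ ()
another-vertex (suc _) = zero , λ ()

proposition1 : (n : ℕ) → n ≥ 2 → (G : Graph n) → (∀ v → v ∈ Graph.V G) →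
    (A B : Subset n) → IsBipartition G A B → Connected G →
    α-stable G ⇔
      (Σ ℕ λ k → 1 ≤ k × Σ (Fin k → Graph n) λ Gs →
        (∀ i → IsSubgraph (Gs i) G) ×
        (∀ i → ∃ λ v → v ∈ Graph.V (Gs i)) ×
        (∀ v → ∃ λ i → v ∈ Graph.V (Gs i)) ×
        (∀ i j v → v ∈ Graph.V (Gs i) → v ∈ Graph.V (Gs j) → i ≡ j) ×
        (∀ i → IsBipartition (Gs i) (A ∩ Graph.V (Gs i)) (B ∩ Graph.V (Gs i))
             × Bistable (Gs i) (A ∩ Graph.V (Gs i)) (B ∩ Graph.V (Gs i))
             × α-stable (Gs i)))
proposition1 (suc zero) (s≤s ())
proposition1 (suc (suc n)) _ G all∈V A B bip connected = mk⇔ forward backward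
  where
  forward : α-stable G → BistablePartition G A B
  forward α-st = decomposition⇒bistable-partition {G = G} all∈V
    (Decompose.α-stable⇒decomposition G all∈V bip α-st
      (connected⇒no-isolated-vertex G all∈V connected another-vertex) (zero , all∈V zero))
  backward : BistablePartition G A B → α-stable G
  backward (k , _ , Gs , Gs⊆G , _ , cover , disjoint , blocks) =
    bistable-blocks⇒α-stable G all∈V bip Gs Gs⊆G cover disjoint blocks
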